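{- Let $P=\mathbf{r}\times\mathbf{c}$ be the product of two finite chains, with gridwork $(R,C)$ where the rows are the chains $\{(i,j): 1\le j\le c\}$ for fixed $i$ and the columns are the chains $\{(i,j):1\le i\le r\}$ for fixed $j$. Let $\lambda$ be a labeling of $P$. Then $\lambda$ is sort-invariant, i.e. $\mathcal{R}\mathcal{C}(\lambda)=\mathcal{C}\mathcal{R}(\lambda)$, if and only if every nonempty corner-set in $P$ is good for $\lambda$.
   Context: A labeling of a finite poset $P$ is a bijection $\lambda: P\to\{1,\ldots,|P|\}$. The operation $\mathcal{R}$ takes a labeling and, within each row separately, permutes the labels of that row so they increase along the row's chain order; $\mathcal{C}$ does the same within each column. $\mathcal{R}\mathcal{C}(\lambda)$ means apply $\mathcal{C}$ first, then $\mathcal{R}$. Corner-sets: for $x,y\in P$ in neither the same row nor the same column, with $x$ in row $r_x$, column $c_x$ and $y$ in row $r_y$, column $c_y$, let $\lozenge(x,y)=(r_x\cup r_y)\cap(c_x\cup c_y)=\{x,y\}\cup(r_x\cap c_y)\cup(c_x\cap r_y)$; if $x,y$ share a row or column, $\lozenge(x,y)=\emptyset$. A nonempty corner-set is bad for $\lambda$ if $|\lozenge(x,y)|>2$ and either: (i) $\lozenge(x,y)=\{x,y,w,z\}$ and $\lambda(x),\lambda(y)>\lambda(w),\lambda(z)$ or $\lambda(x),\lambda(y)<\lambda(w),\lambda(z)$; (ii) $\lozenge(x,y)=\{x,y,z\}$ with $x,y<z$ and $\lambda(x),\lambda(y)>\lambda(z)$; (iii) $\lozenge(x,y)=\{x,y,z\}$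 with $x,y>z$ and $\lambda(x),\lambda(y)<\lambda(z)$. Otherwise it is good. -}

module Defs where

open import Data.Nat using (ℕ; zero; suc; _*_)
open import Data.Fin using (Fin; toℕ; _<_)
open import Data.Fin.Properties using (≤-decTotalOrder)
open import Data.List using (List; []; _∷_; map; allFin)
open import Data.Product using (_×_; _,_; proj₁; proj₂)
open import Data.Sum using (_⊎_)
open import Relation.Binary.PropositionalEquality using (_≡_)
open import Function.Definitions using (Bijective)
open import Relation.Nullary using (¬_)
import Data.List.Sort as Sort

Elem : ℕ → ℕ → Set
Elem r c = Fin r × Fin c

-- A labeling: a bijection P → {1,…,rc}. We use the order-isomorphic label set
-- Fin (r * c) = {0,…,rc-1} (shift by one; only the relative order of labels matters).
Labeling : ℕ → ℕ → Set
Labeling r c = Elem r c → Fin (r * c)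

IsLabeling : ∀ {r c} → Labeling r c → Set
IsLabeling {r} {c} λ′ = Bijective _≡_ _≡_ λ′

-- n-th element of a list, with a default (never used below, since lengths match).
nthOr : ∀ {A : Set} → A → List A → ℕ → A
nthOr d []       _       = d
nthOr d (x ∷ xs) zero    = x
nthOr d (x ∷ xs) (suc n) = nthOr d xs n

module _ {r c : ℕ} where
  private
    module S = Sort (≤-decTotalOrder (r * c))

  sortRows : Labeling r c → Labeling r c
  sortRows L (i , j) = nthOr (L (i , j)) (S.sort (map (λ j′ → L (i , j′)) (allFin c))) (toℕ j)

  sortCols : Labeling r c → Labeling r c
  sortCols L (i , j) = nthOr (L (i , j)) (S.sort (map (λ i′ → L (i′ , j)) (allFin r))) (toℕ i)

  RC : Labeling r c → Labeling r c
  RC L = sortRows (sortCols L)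

  CR : Labeling r c → Labeling r c
  CR L = sortCols (sortRows L)

  SortInvariant : Labeling r c → Set
  SortInvariant L = ∀ p → RC L p ≡ CR L p

  -- Corner-set of x = (a , b), y = (a′ , b′): if they share a row or a column it is ∅;
  -- otherwise (in the grid r × c) it is {x, y, w, z} with w = (a , b′) = r_x ∩ c_y,
  -- z = (a′ , b) = c_x ∩ r_y, always of size 4, so only case (i) of badness can occur.
  NonemptyCorner : Elem r c → Elem r c → Set
  NonemptyCorner x y = ¬ (proj₁ x ≡ proj₁ y) × ¬ (proj₂ x ≡ proj₂ y)

  cornerW : Elem r c → Elem r c → Elem r c
  cornerW x y = (proj₁ x , proj₂ y)

  cornerZ : Elem r c → Elem r c → Elem r c
  cornerZ x y = (proj₁ y , proj₂ x)

  BadCorner : Labeling r c → Elem r c → Elem r c → Set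
  BadCorner L x y =
    let w = cornerW x y ; z = cornerZ x y in
    NonemptyCorner x y ×
    ( (L w < L x × L z < L x × L w < L y × L z < L y)
    ⊎ (L x < L w × L x < L z × L y < L w × L y < L z) )

  GoodCorner : Labeling r c → Elem r c → Elem r c → Set
  GoodCorner L x y = ¬ BadCorner L x y

  AllNonemptyCornersGood : Labeling r c → Set
  AllNonemptyCornersGood L = ∀ x y → NonemptyCorner x y → GoodCorner L x y

-- Cut a labeling at a threshold t: the cells with label below t form a 0/1 matrix, and
-- sorting commutes with this cut (the k-th smallest entry of a list is below t iff k is less
-- than the number of entries below t). On 0/1 matrices 𝓡𝓒 and 𝓒𝓡 turn the column counts,
-- resp. the row counts, into a staircase, and a corner-set is bad iff some cut contains a
-- crossing: 1s at (a , b), (a′ , b′) and 0s at (a , b′), (a′ , b).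
--
-- A crossing-free matrix has its rows nested, so the shortest row among those with more than
-- j ones lies inside all of them, which forces 𝓡𝓒 = 𝓒𝓡. Conversely, raising t switches on one
-- cell at a time; the first crossing to appear contradicts sort-invariance of the new cut at
-- the cell (H , s), where s is the length of the row that grew and H the number of rows longer
-- than it.
module Submission where

open import Defs
open import Data.Bool using (Bool; true; false; T) renaming (_≟_ to _≟ᵇ_)
open import Data.Empty using (⊥; ⊥-elim)
open import Data.Fin as Fin using (Fin; zero; suc; toℕ; fromℕ<)
open import Data.Fin.Properties
  using (any?; _≟_; toℕ<n; toℕ-fromℕ<; toℕ-injective; suc-injective)
  renaming (≤-decTotalOrder to ≤ᶠ-decTotalOrder; ≤-trans to ≤ᶠ-trans)
open import Data.List using (List; []; _∷_; map; allFin; tabulate; length)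
open import Data.List.Properties using (map-tabulate; length-map; length-tabulate)
open import Data.List.Relation.Unary.All using (All; []; _∷_)
open import Data.List.Relation.Unary.AllPairs using (AllPairs; []; _∷_)
open import Data.List.Relation.Unary.Linked.Properties using (Linked⇒AllPairs)
open import Data.List.Relation.Binary.Permutation.Propositional.Properties using (map⁺; ↭-length)
open import Data.Nat using (ℕ; _+_; _*_; _⊔_; _≤_; _<_; _<?_; z≤n; s≤s; _<ᵇ_)
open import Data.Nat.ListAction using (sum)
open import Data.Nat.ListAction.Properties using (sum-↭)
open import Data.Nat.Properties
  using ( ≤-refl; ≤-trans; ≤-antisym; ≤-pred; <-≤-trans; ≤-<-trans; ≮⇒≥; <⇒≱; ≤⇒≯
        ; n<1+n; m<n⇒m<1+n; +-mono-≤; +-mono-≤-<; +-suc; m≤m⊔n; m≤n⊔m; ⊔-lub; <ᵇ⇒<; <⇒<ᵇ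
        ; module ≤-Reasoning)
open import Data.Product using (_×_; _,_; proj₁; proj₂; Σ; ∃)
open import Data.Sum using (inj₁; inj₂)
open import Function using (_∘_)
open import Function.Definitions using (Injective)
open import Relation.Nullary using (yes; no)
open import Relation.Nullary.Decidable using (_×-dec_)
open import Relation.Unary using (Decidable)
open import Relation.Binary.PropositionalEquality
import Data.List.Sort as Sort

private
  true≢false : true ≢ false
  true≢false ()

  bool-ext : ∀ {a b : Bool} → (a ≡ true → b ≡ true) → (b ≡ true → a ≡ true) → a ≡ b
  bool-ext {false} {false} _ _ = refl
  bool-ext {false} {true}  _ b⇒a = b⇒a refl
  bool-ext {true}        a⇒b _ = sym (a⇒b refl)

  bit : Bool → ℕ
  bit true  = 1
  bit false = 0

  bit-mono : ∀ {a b} → (a ≡ true → b ≡ true) → bit a ≤ bit b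
  bit-mono {false}     _   = z≤n
  bit-mono {true}  a⇒b rewrite a⇒b refl = ≤-refl

<⇒<ᵇ≡true : ∀ {m n} → m < n → (m <ᵇ n) ≡ true
<⇒<ᵇ≡true {m} {n} m<n with m <ᵇ n | <⇒<ᵇ m<n
... | true | _ = refl

<ᵇ≡true⇒< : ∀ {m n} → (m <ᵇ n) ≡ true → m < n
<ᵇ≡true⇒< {m} {n} m<ᵇn = <ᵇ⇒< m n (subst T (sym m<ᵇn) _)

≥⇒<ᵇ≡false : ∀ {m n} → n ≤ m → (m <ᵇ n) ≡ false
≥⇒<ᵇ≡false {m} {n} n≤m with m <ᵇ n in m<ᵇn
... | false = refl
... | true  = ⊥-elim (≤⇒≯ n≤m (<ᵇ≡true⇒< m<ᵇn))

<ᵇ≡false⇒≥ : ∀ {m n} → (m <ᵇ n) ≡ false → n ≤ m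
<ᵇ≡false⇒≥ m<ᵇn = ≮⇒≥ (λ m<n → true≢false (trans (sym (<⇒<ᵇ≡true m<n)) m<ᵇn))

count : ∀ {n} → (Fin n → Bool) → ℕ
count {ℕ.zero}  f = 0
count {ℕ.suc n} f = bit (f zero) + count (f ∘ suc)

count-cong : ∀ {n} {f g : Fin n → Bool} → (∀ x → f x ≡ g x) → count f ≡ count g
count-cong {ℕ.zero}  f≗g = refl
count-cong {ℕ.suc n} f≗g = cong₂ _+_ (cong bit (f≗g zero)) (count-cong (f≗g ∘ suc))

count≤n : ∀ {n} (f : Fin n → Bool) → count f ≤ n
count≤n {ℕ.zero}  f = z≤n
count≤n {ℕ.suc n} f = +-mono-≤ (bit≤1 (f zero)) (count≤n (f ∘ suc))
  where
  bit≤1 : ∀ b → bit b ≤ 1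
  bit≤1 true  = ≤-refl
  bit≤1 false = z≤n

count-mono : ∀ {n} {f g : Fin n → Bool} → (∀ x → f x ≡ true → g x ≡ true) → count f ≤ count g
count-mono {ℕ.zero}  f⊆g = z≤n
count-mono {ℕ.suc n} f⊆g = +-mono-≤ (bit-mono (f⊆g zero)) (count-mono (f⊆g ∘ suc))

count-mono-< : ∀ {n} {f g : Fin n → Bool} → (∀ x → f x ≡ true → g x ≡ true) →
               ∀ e → f e ≡ false → g e ≡ true → count f < count g
count-mono-< {ℕ.suc n} f⊆g zero    fe ge rewrite fe | ge = s≤s (count-mono (f⊆g ∘ suc))
count-mono-< {ℕ.suc n} f⊆g (suc e) fe ge =
  +-mono-≤-< (bit-mono (f⊆g zero)) (count-mono-< (f⊆g ∘ suc) e fe ge)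

count-insert : ∀ {n} {f g : Fin n → Bool} e → (∀ x → x ≢ e → g x ≡ f x) →
               f e ≡ false → g e ≡ true → count g ≡ ℕ.suc (count f)
count-insert {ℕ.suc n} zero g≗f fe ge rewrite fe | ge =
  cong ℕ.suc (count-cong (λ x → g≗f (suc x) (λ ())))
count-insert {ℕ.suc n} {f} {g} (suc e) g≗f fe ge rewrite g≗f zero (λ ()) =
  trans (cong (bit (f zero) +_) (count-insert e (λ x x≢e → g≗f (suc x) (x≢e ∘ suc-injective)) fe ge))
        (+-suc (bit (f zero)) _)

count>0⇒∃ : ∀ {n} (f : Fin n → Bool) → 0 < count f → ∃ λ x → f x ≡ true
count>0⇒∃ {ℕ.suc n} f count>0 with f zero in f0
... | true  = zero , f0
... | false with count>0⇒∃ (f ∘ suc) count>0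
...   | x , fx = suc x , fx

minimiser : ∀ {n} {P : Fin n → Set} → Decidable P → (w : Fin n → ℕ) →
            ∃ P → Σ (Fin n) λ p → P p × (∀ x → P x → w p ≤ w x)
minimiser {n} {P} P? w (x , px) = descend (ℕ.suc (w x)) x px (n<1+n (w x))
  where
  descend : ∀ bound x → P x → w x < bound → Σ (Fin n) λ p → P p × (∀ y → P y → w p ≤ w y)
  descend (ℕ.suc bound) x px wx<bound with any? (λ y → P? y ×-dec w y <? w x)
  ... | yes (y , py , wy<wx) = descend bound y py (<-≤-trans wy<wx (≤-pred wx<bound))
  ... | no ∄smaller          = x , px , λ y py → ≮⇒≥ (λ wy<wx → ∄smaller (y , py , wy<wx))

-- Sorting commutes with thresholds

below : ∀ {N} → ℕ → Fin N → Bool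
below t x = toℕ x <ᵇ t

sum-tabulate-below : ∀ {N n} t (g : Fin n → Fin N) →
                     sum (map (bit ∘ below t) (tabulate g)) ≡ count (below t ∘ g)
sum-tabulate-below {n = ℕ.zero}  t g = refl
sum-tabulate-below {n = ℕ.suc n} t g = cong (bit (below t (g zero)) +_) (sum-tabulate-below t (g ∘ suc))

module _ {N : ℕ} (t : ℕ) where

  private
    nthOr-All : ∀ {P : Fin N → Set} d s k → All P s → k < length s → P (nthOr d s k)
    nthOr-All d (x ∷ s) ℕ.zero    (px ∷ _)   _         = px
    nthOr-All d (x ∷ s) (ℕ.suc k) (_  ∷ pxs) (s≤s k<) = nthOr-All d s k pxs k<

    none-below : ∀ {x : Fin N} s → t ≤ toℕ x → All (λ (y : Fin N) → x Fin.≤ y) s →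
                 sum (map (bit ∘ below t) s) ≡ 0
    none-below []      t≤x []          = refl
    none-below (y ∷ s) t≤x (x≤y ∷ x≤s) rewrite ≥⇒<ᵇ≡false {toℕ y} (≤-trans t≤x x≤y) =
      none-below s t≤x x≤s

  sorted-nthOr-below : ∀ d s k → AllPairs (λ (x y : Fin N) → x Fin.≤ y) s → k < length s →
                       below t (nthOr d s k) ≡ (k <ᵇ sum (map (bit ∘ below t) s))
  sorted-nthOr-below d (x ∷ s) k (x≤s ∷ sorted) k< with below t x in x<t
  sorted-nthOr-below d (x ∷ s) ℕ.zero    (x≤s ∷ sorted) k<        | true = x<t
  sorted-nthOr-below d (x ∷ s) (ℕ.suc k) (x≤s ∷ sorted) (s≤s k<) | true =
    sorted-nthOr-below d s k sorted k<
  sorted-nthOr-below d (x ∷ s) ℕ.zero    (x≤s ∷ sorted) k<        | false =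
    trans x<t (cong (ℕ.zero <ᵇ_) (sym (none-below s (<ᵇ≡false⇒≥ x<t) x≤s)))
  sorted-nthOr-below d (x ∷ s) (ℕ.suc k) (x≤s ∷ sorted) (s≤s k<) | false =
    trans (≥⇒<ᵇ≡false {n = t} (≤-trans (<ᵇ≡false⇒≥ x<t) (nthOr-All d s k x≤s k<)))
          (cong (ℕ.suc k <ᵇ_) (sym (none-below s (<ᵇ≡false⇒≥ x<t) x≤s)))

  nthOr-sort-below : ∀ {n} (h : Fin n → Fin N) (d : Fin N) (i : Fin n) →
    let open Sort (≤ᶠ-decTotalOrder N) in
    below t (nthOr d (sort (map h (allFin n))) (toℕ i)) ≡ (toℕ i <ᵇ count (below t ∘ h))
  nthOr-sort-below {n} h d i =
    trans (sorted-nthOr-below d (sort xs) (toℕ i) (Linked⇒AllPairs ≤ᶠ-trans (sort-↗ xs)) i<length)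
          (cong (toℕ i <ᵇ_) #below)
    where
    open Sort (≤ᶠ-decTotalOrder N)
    xs : List (Fin N)
    xs = map h (allFin n)
    i<length : toℕ i < length (sort xs)
    i<length rewrite ↭-length (sort-↭ xs) | length-map h (allFin n) | length-tabulate {n = n} (λ x → x) =
      toℕ<n i
    #below : sum (map (bit ∘ below t) (sort xs)) ≡ count (below t ∘ h)
    #below = begin
      sum (map (bit ∘ below t) (sort xs))      ≡⟨ sum-↭ (map⁺ (bit ∘ below t) (sort-↭ xs)) ⟩
      sum (map (bit ∘ below t) xs)             ≡⟨ cong (sum ∘ map (bit ∘ below t)) (map-tabulate (λ x → x) h) ⟩
      sum (map (bit ∘ below t) (tabulate h))  ≡⟨ sum-tabulate-below t h ⟩
      count (below t ∘ h)                      ∎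
      where open ≡-Reasoning

Matrix : ℕ → ℕ → Set
Matrix r c = Fin r → Fin c → Bool

module _ {r c : ℕ} where

  rowCount : Matrix r c → Fin r → ℕ
  rowCount B i = count (B i)

  colCount : Matrix r c → Fin c → ℕ
  colCount B j = count (λ i → B i j)

  sortRowsᵇ sortColsᵇ : Matrix r c → Matrix r c
  sortRowsᵇ B i j = toℕ j <ᵇ rowCount B i
  sortColsᵇ B i j = toℕ i <ᵇ colCount B j

  SortInvariantᵇ : Matrix r c → Set
  SortInvariantᵇ B = ∀ i j → sortRowsᵇ (sortColsᵇ B) i j ≡ sortColsᵇ (sortRowsᵇ B) i j

  -- Equivalently, the supports of the rows form a chain under inclusion.
  Nested : Matrix r c → Set
  Nested B = ∀ a a′ b b′ → B a b ≡ true → B a′ b′ ≡ true → B a b′ ≡ false → B a′ b ≡ false → ⊥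

transpose : ∀ {r c} → Matrix r c → Matrix c r
transpose B j i = B i j

Nested-transpose : ∀ {r c} {B : Matrix r c} → Nested B → Nested (transpose B)
Nested-transpose nested b b′ a a′ Bab Ba′b′ Ba′b Bab′ = nested a a′ b b′ Bab Ba′b′ Bab′ Ba′b

module _ {r c : ℕ} {B : Matrix r c} (nested : Nested B) where

  Nested-rowCount-< : ∀ {p i k} → B i k ≡ true → B p k ≡ false → rowCount B p < rowCount B i
  Nested-rowCount-< {p} {i} {k} Bik Bpk = count-mono-< row-p⊆row-i k Bpk Bik
    where
    row-p⊆row-i : ∀ j → B p j ≡ true → B i j ≡ true
    row-p⊆row-i j Bpj with B i j in Bij
    ... | true  = refl
    ... | false = ⊥-elim (nested p i j k Bpj Bik Bpk Bij)

  Nested-row-⊆ : ∀ {p i j} → rowCount B p ≤ rowCount B i → B p j ≡ true → B i j ≡ true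
  Nested-row-⊆ {p} {i} {j} p≤i Bpj with B i j in Bij
  ... | true  = refl
  ... | false = ⊥-elim (<⇒≱ (Nested-rowCount-< Bpj Bij) p≤i)

  Nested-CR⇒RC : ∀ i j → sortColsᵇ (sortRowsᵇ B) i j ≡ true → sortRowsᵇ (sortColsᵇ B) i j ≡ true
  Nested-CR⇒RC i j CRij =
    shortest-long-row⇒RC (minimiser (λ i′ → long i′ ≟ᵇ true) (rowCount B)
                                     (count>0⇒∃ long (≤-<-trans z≤n i<#long)))
    where
    long : Fin r → Bool
    long i′ = toℕ j <ᵇ rowCount B i′
    i<#long : toℕ i < count long
    i<#long = <ᵇ≡true⇒< CRij
    shortest-long-row⇒RC :
      Σ (Fin r) (λ p → long p ≡ true × (∀ i′ → long i′ ≡ true → rowCount B p ≤ rowCount B i′)) →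
      sortRowsᵇ (sortColsᵇ B) i j ≡ true
    shortest-long-row⇒RC (p , long-p , shortest) = <⇒<ᵇ≡true (begin-strict
        toℕ j                                  <⟨ <ᵇ≡true⇒< long-p ⟩
        rowCount B p                           ≤⟨ count-mono (λ j′ → <⇒<ᵇ≡true ∘ column-long j′) ⟩
        count (λ j′ → toℕ i <ᵇ colCount B j′)  ∎)
      where
      open ≤-Reasoning
      column-long : ∀ j′ → B p j′ ≡ true → toℕ i < colCount B j′
      column-long j′ Bpj′ =
        <-≤-trans i<#long (count-mono (λ i′ long-i′ → Nested-row-⊆ (shortest i′ long-i′) Bpj′))

Nested⇒SortInvariantᵇ : ∀ {r c} {B : Matrix r c} → Nested B → SortInvariantᵇ B
Nested⇒SortInvariantᵇ nested i j =
  bool-ext (Nested-CR⇒RC (Nested-transpose nested) j i) (Nested-CR⇒RC nested i j)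

module AddCell {r c : ℕ} {B B′ : Matrix r c} (nested : Nested B)
  (invariant : SortInvariantᵇ B) (invariant′ : SortInvariantᵇ B′)
  {p : Fin r} {q : Fin c} (off : B p q ≡ false) (on : B′ p q ≡ true)
  (unchanged : ∀ i j → (i , j) ≢ (p , q) → B′ i j ≡ B i j) where

  private
    rowCount-unchanged : ∀ i → i ≢ p → rowCount B′ i ≡ rowCount B i
    rowCount-unchanged i i≢p = count-cong (λ j → unchanged i j (i≢p ∘ cong proj₁))

    rowCount-grows : rowCount B′ p ≡ ℕ.suc (rowCount B p)
    rowCount-grows = count-insert q (λ j j≢q → unchanged p j (j≢q ∘ cong proj₂)) off on

    colCount-unchanged : ∀ j → j ≢ q → colCount B′ j ≡ colCount B j
    colCount-unchanged j j≢q = count-cong (λ i → unchanged i j (j≢q ∘ cong proj₂))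

    colCount-grows : colCount B′ q ≡ ℕ.suc (colCount B q)
    colCount-grows = count-insert p (λ i i≢p → unchanged i q (i≢p ∘ cong proj₁)) off on

    s : ℕ
    s = rowCount B p

    longer : Matrix r c → Fin r → Bool
    longer M i = s <ᵇ rowCount M i

    H : ℕ
    H = count (longer B)

    #longer′ : count (longer B′) ≡ ℕ.suc H
    #longer′ = count-insert p (λ i i≢p → cong (s <ᵇ_) (rowCount-unchanged i i≢p))
                 (≥⇒<ᵇ≡false {s} ≤-refl) (trans (cong (s <ᵇ_) rowCount-grows) (<⇒<ᵇ≡true (n<1+n s)))

    H<r : H < r
    H<r = subst (_≤ r) #longer′ (count≤n (longer B′))

    s<c : s < c
    s<c = subst (_≤ c) rowCount-grows (count≤n (B′ p))

    i₀ : Fin r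
    i₀ = fromℕ< H<r

    j₀ : Fin c
    j₀ = fromℕ< s<c

    CR′-true : sortColsᵇ (sortRowsᵇ B′) i₀ j₀ ≡ true
    CR′-true rewrite toℕ-fromℕ< H<r | toℕ-fromℕ< s<c | #longer′ = <⇒<ᵇ≡true (n<1+n H)

    RC-false : sortRowsᵇ (sortColsᵇ B) i₀ j₀ ≡ false
    RC-false = trans (invariant i₀ j₀) CR-false
      where
      CR-false : sortColsᵇ (sortRowsᵇ B) i₀ j₀ ≡ false
      CR-false rewrite toℕ-fromℕ< H<r | toℕ-fromℕ< s<c = ≥⇒<ᵇ≡false {H} ≤-refl

  no-crossing-at-new-cell : ∀ a′ b′ → B′ a′ b′ ≡ true → B′ p b′ ≡ false → B′ a′ q ≡ false → ⊥
  no-crossing-at-new-cell a′ b′ B′a′b′ B′pb′ B′a′q =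
    true≢false (trans (sym CR′-true) (trans (sym (invariant′ i₀ j₀)) RC′-false))
    where
    a′≢p : a′ ≢ p
    a′≢p refl = true≢false (trans (sym B′a′b′) B′pb′)

    b′≢q : b′ ≢ q
    b′≢q refl = true≢false (trans (sym on) B′pb′)

    Ba′b′ : B a′ b′ ≡ true
    Ba′b′ = trans (sym (unchanged a′ b′ (a′≢p ∘ cong proj₁))) B′a′b′

    Bpb′ : B p b′ ≡ false
    Bpb′ = trans (sym (unchanged p b′ (b′≢q ∘ cong proj₂))) B′pb′

    Ba′q : B a′ q ≡ false
    Ba′q = trans (sym (unchanged a′ q (a′≢p ∘ cong proj₁))) B′a′q

    -- Every row meeting column q is longer than row p, and so is row a′, which misses it.
    colCount<H : colCount B q < H
    colCount<H = count-mono-< (λ i Biq → <⇒<ᵇ≡true (Nested-rowCount-< nested Biq off)) a′ Ba′q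
                   (<⇒<ᵇ≡true (Nested-rowCount-< nested Ba′b′ Bpb′))

    no-column-grows-past-i₀ : ∀ j → (toℕ i₀ <ᵇ colCount B′ j) ≡ true → (toℕ i₀ <ᵇ colCount B j) ≡ true
    no-column-grows-past-i₀ j i₀<B′j with j ≟ q
    ... | no  j≢q  = trans (cong (toℕ i₀ <ᵇ_) (sym (colCount-unchanged j j≢q))) i₀<B′j
    ... | yes refl = ⊥-elim (<⇒≱ colCount<H (≤-pred i₀<col))
      where
      i₀<col : H < ℕ.suc (colCount B q)
      i₀<col = subst₂ _<_ (toℕ-fromℕ< H<r) colCount-grows (<ᵇ≡true⇒< i₀<B′j)

    RC′-false : sortRowsᵇ (sortColsᵇ B′) i₀ j₀ ≡ false
    RC′-false = ≥⇒<ᵇ≡false (≤-trans (count-mono no-column-grows-past-i₀) (<ᵇ≡false⇒≥ RC-false))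

module _ {r c : ℕ} {B B′ : Matrix r c}
  (B⊆B′ : ∀ i j → B i j ≡ true → B′ i j ≡ true)
  (new-unique : ∀ {i j i′ j′} → B i j ≡ false → B′ i j ≡ true → B i′ j′ ≡ false → B′ i′ j′ ≡ true →
                (i , j) ≡ (i′ , j′)) where

  private
    shrink : ∀ i j → B′ i j ≡ false → B i j ≡ false
    shrink i j B′ij with B i j in Bij
    ... | false = refl
    ... | true  = ⊥-elim (true≢false (trans (sym (B⊆B′ i j Bij)) B′ij))

    unchanged : ∀ {p q} → B p q ≡ false → B′ p q ≡ true → ∀ i j → (i , j) ≢ (p , q) → B′ i j ≡ B i j
    unchanged off on i j ≢pq with B i j in Bij | B′ i j in B′ij
    ... | true  | true  = refl
    ... | false | false = refl
    ... | true  | false = ⊥-elim (true≢false (trans (sym (B⊆B′ i j Bij)) B′ij))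
    ... | false | true  = ⊥-elim (≢pq (new-unique Bij B′ij off on))

  Nested-extend : Nested B → SortInvariantᵇ B → SortInvariantᵇ B′ → Nested B′
  Nested-extend nested inv inv′ a a′ b b′ B′ab B′a′b′ B′ab′ B′a′b with B a b in Bab | B a′ b′ in Ba′b′
  ... | true  | true  = nested a a′ b b′ Bab Ba′b′ (shrink a b′ B′ab′) (shrink a′ b B′a′b)
  ... | false | _     = AddCell.no-crossing-at-new-cell nested inv inv′ Bab B′ab (unchanged Bab B′ab)
                          a′ b′ B′a′b′ B′ab′ B′a′b
  ... | true  | false = AddCell.no-crossing-at-new-cell nested inv inv′ Ba′b′ B′a′b′ (unchanged Ba′b′ B′a′b′)
                          a b B′ab B′a′b B′ab′

-- Labelings through their threshold matrices

below-injective : ∀ {N} {x y : Fin N} → (∀ t → below t x ≡ below t y) → x ≡ y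
below-injective {x = x} {y} x≈y = toℕ-injective (≤-antisym (≤-from x≈y) (≤-from (sym ∘ x≈y)))
  where
  ≤-from : ∀ {u v : Fin _} → (∀ t → below t u ≡ below t v) → toℕ u ≤ toℕ v
  ≤-from {u} {v} u≈v = ≤-pred (<ᵇ≡true⇒< (trans (u≈v (ℕ.suc (toℕ v))) (<⇒<ᵇ≡true (n<1+n (toℕ v)))))

module _ {r c : ℕ} where

  threshold : Labeling r c → ℕ → Matrix r c
  threshold L t i j = below t (L (i , j))

  threshold-sortCols : ∀ L t i j → threshold (sortCols L) t i j ≡ sortColsᵇ (threshold L t) i j
  threshold-sortCols L t i j = nthOr-sort-below t (λ i′ → L (i′ , j)) (L (i , j)) i

  threshold-sortRows : ∀ L t i j → threshold (sortRows L) t i j ≡ sortRowsᵇ (threshold L t) i j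
  threshold-sortRows L t i j = nthOr-sort-below t (λ j′ → L (i , j′)) (L (i , j)) j

  threshold-RC : ∀ L t i j → threshold (RC L) t i j ≡ sortRowsᵇ (sortColsᵇ (threshold L t)) i j
  threshold-RC L t i j = trans (threshold-sortRows (sortCols L) t i j)
                               (cong (toℕ j <ᵇ_) (count-cong (threshold-sortCols L t i)))

  threshold-CR : ∀ L t i j → threshold (CR L) t i j ≡ sortColsᵇ (sortRowsᵇ (threshold L t)) i j
  threshold-CR L t i j = trans (threshold-sortCols (sortRows L) t i j)
                               (cong (toℕ i <ᵇ_) (count-cong (λ i′ → threshold-sortRows L t i′ j)))

  SortInvariant⇒thresholds : ∀ {L} → SortInvariant L → ∀ t → SortInvariantᵇ (threshold L t)
  SortInvariant⇒thresholds {L} inv t i j =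
    trans (sym (threshold-RC L t i j)) (trans (cong (below t) (inv (i , j))) (threshold-CR L t i j))

  thresholds⇒SortInvariant : ∀ {L} → (∀ t → SortInvariantᵇ (threshold L t)) → SortInvariant L
  thresholds⇒SortInvariant {L} inv (i , j) = below-injective λ t →
    trans (threshold-RC L t i j) (trans (inv t i j) (sym (threshold-CR L t i j)))

  threshold-mono : ∀ L t i j → threshold L t i j ≡ true → threshold L (ℕ.suc t) i j ≡ true
  threshold-mono L t i j ij<t = <⇒<ᵇ≡true (m<n⇒m<1+n (<ᵇ≡true⇒< {toℕ (L (i , j))} ij<t))

  threshold-new-label : ∀ L t {i j} → threshold L t i j ≡ false → threshold L (ℕ.suc t) i j ≡ true →
                        toℕ (L (i , j)) ≡ t
  threshold-new-label L t {i} {j} off on =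
    ≤-antisym (≤-pred (<ᵇ≡true⇒< {toℕ (L (i , j))} on)) (<ᵇ≡false⇒≥ {toℕ (L (i , j))} off)

  thresholds-nested : ∀ {L} → Injective _≡_ _≡_ L → (∀ t → SortInvariantᵇ (threshold L t)) →
                      ∀ t → Nested (threshold L t)
  thresholds-nested inj inv ℕ.zero _ _ _ _ ()
  thresholds-nested {L} inj inv (ℕ.suc t) =
    Nested-extend (threshold-mono L t) new-label-unique (thresholds-nested inj inv t) (inv t) (inv (ℕ.suc t))
    where
    new-label-unique : ∀ {i j i′ j′} →
      threshold L t i j ≡ false → threshold L (ℕ.suc t) i j ≡ true →
      threshold L t i′ j′ ≡ false → threshold L (ℕ.suc t) i′ j′ ≡ true → (i , j) ≡ (i′ , j′)
    new-label-unique off on off′ on′ =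
      inj (toℕ-injective (trans (threshold-new-label L t off on) (sym (threshold-new-label L t off′ on′))))

  no-separated-crossing : ∀ {L} → (∀ t → Nested (threshold L t)) → ∀ a a′ b b′ →
    L (a , b) Fin.< L (a , b′) → L (a , b) Fin.< L (a′ , b) →
    L (a′ , b′) Fin.< L (a , b′) → L (a′ , b′) Fin.< L (a′ , b) → ⊥
  no-separated-crossing {L} nested a a′ b b′ ab<ab′ ab<a′b a′b′<ab′ a′b′<a′b =
    nested (ℕ.suc (ℓ a b ⊔ ℓ a′ b′)) a a′ b b′
      (<⇒<ᵇ≡true (s≤s (m≤m⊔n (ℓ a b) (ℓ a′ b′)))) (<⇒<ᵇ≡true (s≤s (m≤n⊔m (ℓ a b) (ℓ a′ b′))))
      (≥⇒<ᵇ≡false (⊔-lub ab<ab′ a′b′<ab′)) (≥⇒<ᵇ≡false (⊔-lub ab<a′b a′b′<a′b))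
    where
    ℓ : Fin r → Fin c → ℕ
    ℓ i j = toℕ (L (i , j))

  thresholds-nested⇒good : ∀ {L} → (∀ t → Nested (threshold L t)) → AllNonemptyCornersGood L
  thresholds-nested⇒good nested (a , b) (a′ , b′) _ (_ , inj₁ (w<x , z<x , w<y , z<y)) =
    no-separated-crossing nested a a′ b′ b w<x w<y z<x z<y
  thresholds-nested⇒good nested (a , b) (a′ , b′) _ (_ , inj₂ (x<w , x<z , y<w , y<z)) =
    no-separated-crossing nested a a′ b b′ x<w x<z y<w y<z

  good⇒thresholds-nested : ∀ {L} → AllNonemptyCornersGood L → ∀ t → Nested (threshold L t)
  good⇒thresholds-nested {L} good t a a′ b b′ ab a′b′ ab′ a′b =
    good (a , b) (a′ , b′) corner
      (corner , inj₂ (below<above ab ab′ , below<above ab a′b , below<above a′b′ ab′ , below<above a′b′ a′b))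
    where
    below<above : ∀ {u v : Fin (r * c)} → below t u ≡ true → below t v ≡ false → u Fin.< v
    below<above {u} {v} u<t t≤v = <-≤-trans (<ᵇ≡true⇒< {toℕ u} {t} u<t) (<ᵇ≡false⇒≥ {toℕ v} {t} t≤v)
    corner : NonemptyCorner (a , b) (a′ , b′)
    corner = (λ { refl → true≢false (trans (sym a′b′) ab′) }) , (λ { refl → true≢false (trans (sym ab) ab′) })

proposition3p7 : (r c : ℕ) (L : Labeling r c) → IsLabeling L →
    (SortInvariant L → AllNonemptyCornersGood L) × (AllNonemptyCornersGood L → SortInvariant L)
proposition3p7 r c L (injective , _) =
  (λ invariant → thresholds-nested⇒good (thresholds-nested injective (SortInvariant⇒thresholds invariant))) ,
  (λ good → thresholds⇒SortInvariant (Nested⇒SortInvariantᵇ ∘ good⇒thresholds-nested good))
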